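{- Let $G,H$ be forks (game forms over $P_2=\{\bot,a,b,\top\}$). If $G$ is pivoting and $G\leq H$, then $H$ is pivoting.
   Context: $P_2$ is ordered by $\bot<a,b<\top$ with $a,b$ incomparable; a fork is any game form over $P_2$. Game forms: atomic $[x]$ (written $x$), $x\in P_2$, or composite $\{L\mid R\}$ with $L,R$ nonempty sets of game forms; atomic games have no options. For a game $K$, $K^{(L)}$ denotes a left option of $K$ if $K$ is composite and $K$ itself if $K$ is atomic; similarly $K^{(R)}$. Mutually recursively: $G\leq H$ iff every $G^{(L)}\lhd H$ and $G\lhd H^{(R)}$ for every $H^{(R)}$; $G\lhd H$ iff some right option $G^R\leq H$, or some left option $H^L$ has $G\leq H^L$, or both are atomic $[x],[y]$ with $x\leq y$. A fork $G$ is pivoting if either $b\leq G$, or $a\lhd G$ and for every right option $G^R$ of $G$ there exists some $G^{R(L)}$ (a left option of $G^R$ if $G^R$ is composite, or $G^R$ itself if atomic) that is pivoting. -}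

module Defs where

open import Data.List.NonEmpty using (List⁺; toList)
open import Data.List.Membership.Propositional using (_∈_)
open import Data.Product using (Σ; _×_; ∃)
open import Data.Sum using (_⊎_)
open import Relation.Binary.PropositionalEquality using (_≡_)

data P₂ : Set where
  bot a b top : P₂

data _≤P_ : P₂ → P₂ → Set where
  refl≤ : ∀ {x} → x ≤P x
  bot≤  : ∀ {x} → bot ≤P x
  ≤top  : ∀ {x} → x ≤P top

data Fork : Set where
  atom : P₂ → Fork
  ⟨_∣_⟩ : List⁺ Fork → List⁺ Fork → Fork

data IsLeftOpt : Fork → Fork → Set where
  lopt : ∀ {L R G} → G ∈ toList L → IsLeftOpt ⟨ L ∣ R ⟩ G

data IsRightOpt : Fork → Fork → Set where
  ropt : ∀ {L R G} → G ∈ toList R → IsRightOpt ⟨ L ∣ R ⟩ G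

-- K^(L): a left option of K if K is composite, K itself if atomic.
data IsLeftOpt* : Fork → Fork → Set where
  latom : ∀ {x} → IsLeftOpt* (atom x) (atom x)
  lcomp : ∀ {K G} → IsLeftOpt K G → IsLeftOpt* K G

-- K^(R): a right option of K if K is composite, K itself if atomic.
data IsRightOpt* : Fork → Fork → Set where
  ratom : ∀ {x} → IsRightOpt* (atom x) (atom x)
  rcomp : ∀ {K G} → IsRightOpt K G → IsRightOpt* K G

data _≤G_ : Fork → Fork → Set
data _⊲_ : Fork → Fork → Set

data _≤G_ where
  le : ∀ {G H}
     → (∀ {G'} → IsLeftOpt* G G' → G' ⊲ H)
     → (∀ {H'} → IsRightOpt* H H' → G ⊲ H')
     → G ≤G H

data _⊲_ where
  tf-right : ∀ {G H G'} → IsRightOpt G G' → G' ≤G H → G ⊲ H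
  tf-left  : ∀ {G H H'} → IsLeftOpt H H' → G ≤G H' → G ⊲ H
  tf-atom  : ∀ {x y} → x ≤P y → atom x ⊲ atom y

data Pivoting : Fork → Set where
  piv-b : ∀ {G} → atom b ≤G G → Pivoting G
  piv-a : ∀ {G} → atom a ⊲ G
        → (∀ {G'} → IsRightOpt G G' → ∃ λ G'' → IsLeftOpt* G' G'' × Pivoting G'')
        → Pivoting G

{-# OPTIONS --safe #-}
-- Both halves are proved together by induction on the derivations of ≤ and ⊲:
-- pivoting forks are closed upwards under ≤, and if G is pivoting and G ⊲ H then
-- some H^(L) is pivoting.  The b-clause survives by transitivity.  For the
-- a-clause, a ⊲ G ≤ H gives a ⊲ H, and every right option H^R has G ⊲ H^R.
-- When G ⊲ H holds through a right option G^R ≤ H, the pivoting G^(R)(L) ⊲ H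
-- supplied by the definition lets the induction continue one level down.
module Submission where

open import Defs
open import Data.Product using (∃; _×_; _,_; map₂)

≤P-trans : ∀ {x y z} → x ≤P y → y ≤P z → x ≤P z
≤P-trans refl≤ q     = q
≤P-trans bot≤  _     = bot≤
≤P-trans ≤top  refl≤ = ≤top
≤P-trans ≤top  ≤top  = ≤top

≤P-⊲-trans  : ∀ {x y K} → x ≤P y → atom y ⊲ K → atom x ⊲ K
≤P-≤G-trans : ∀ {x y K} → x ≤P y → atom y ≤G K → atom x ≤G K
≤P-⊲-trans  xy (tf-right () _)
≤P-⊲-trans  xy (tf-left l p) = tf-left l (≤P-≤G-trans xy p)
≤P-⊲-trans  xy (tf-atom yz)  = tf-atom (≤P-trans xy yz)
≤P-≤G-trans xy (le f g) =
  le (λ { latom → ≤P-⊲-trans xy (f latom) ; (lcomp ()) })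
     (λ r → ≤P-⊲-trans xy (g r))

⊲-≤P-trans  : ∀ {K y z} → K ⊲ atom y → y ≤P z → K ⊲ atom z
≤G-≤P-trans : ∀ {K y z} → K ≤G atom y → y ≤P z → K ≤G atom z
⊲-≤P-trans  (tf-right r p) yz = tf-right r (≤G-≤P-trans p yz)
⊲-≤P-trans  (tf-left () _) yz
⊲-≤P-trans  (tf-atom xy)   yz = tf-atom (≤P-trans xy yz)
≤G-≤P-trans (le f g) yz =
  le (λ l → ⊲-≤P-trans (f l) yz)
     (λ { ratom → ⊲-≤P-trans (g ratom) yz ; (rcomp ()) })

≤G-trans   : ∀ {G H K} → G ≤G H → H ≤G K → G ≤G K
⊲-≤G-trans : ∀ {G H K} → G ⊲ H → H ≤G K → G ⊲ K
≤G-⊲-trans : ∀ {G H K} → G ≤G H → H ⊲ K → G ⊲ K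
≤G-trans G≤H@(le f _) H≤K@(le _ g) =
  le (λ l → ⊲-≤G-trans (f l) H≤K) (λ r → ≤G-⊲-trans G≤H (g r))
⊲-≤G-trans (tf-right r p) H≤K      = tf-right r (≤G-trans p H≤K)
⊲-≤G-trans (tf-left l p)  (le f _) = ≤G-⊲-trans p (f (lcomp l))
⊲-≤G-trans (tf-atom xy)   (le f _) = ≤P-⊲-trans xy (f latom)
≤G-⊲-trans (le _ g) (tf-right r q) = ⊲-≤G-trans (g (rcomp r)) q
≤G-⊲-trans G≤H      (tf-left l q)  = tf-left l (≤G-trans G≤H q)
≤G-⊲-trans (le _ g) (tf-atom yz)   = ⊲-≤P-trans (g ratom) yz

atom-≤G : ∀ {x y} → x ≤P y → atom x ≤G atom y
atom-≤G xy = le (λ { latom → tf-atom xy ; (lcomp ()) })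
                (λ { ratom → tf-atom xy ; (rcomp ()) })

atom-⊲-atom⇒≤P : ∀ {x y} → atom x ⊲ atom y → x ≤P y
atom-⊲-atom⇒≤P (tf-right () _)
atom-⊲-atom⇒≤P (tf-left () _)
atom-⊲-atom⇒≤P (tf-atom xy) = xy

atom-⊲⇒≤G-leftOpt* : ∀ {x K} → atom x ⊲ K → ∃ λ K' → IsLeftOpt* K K' × atom x ≤G K'
atom-⊲⇒≤G-leftOpt* (tf-right () _)
atom-⊲⇒≤G-leftOpt* (tf-left l p) = _ , lcomp l , p
atom-⊲⇒≤G-leftOpt* (tf-atom xy)  = _ , latom , atom-≤G xy

HasPivotingLeftOpt* : Fork → Set
HasPivotingLeftOpt* K = ∃ λ K' → IsLeftOpt* K K' × Pivoting K'

pivoting-atom : ∀ {y} → a ≤P y → Pivoting (atom y)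
pivoting-atom ay = piv-a (tf-atom ay) λ ()

pivoting-≤G : ∀ {G H} → Pivoting G → G ≤G H → Pivoting H
pivoting-⊲  : ∀ {G H} → Pivoting G → G ⊲ H → HasPivotingLeftOpt* H
pivoting-≤G (piv-b b≤G) G≤H = piv-b (≤G-trans b≤G G≤H)
pivoting-≤G pG@(piv-a a⊲G _) G≤H@(le _ g) =
  piv-a (⊲-≤G-trans a⊲G G≤H) (λ r → pivoting-⊲ pG (g (rcomp r)))
pivoting-⊲ (piv-b b≤G) G⊲H =
  map₂ (map₂ piv-b) (atom-⊲⇒≤G-leftOpt* (≤G-⊲-trans b≤G G⊲H))
pivoting-⊲ pG (tf-left l G≤Hᴸ) = _ , lcomp l , pivoting-≤G pG G≤Hᴸ
pivoting-⊲ (piv-a _ h) (tf-right r (le f _)) with h r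
... | _ , l , pQ = pivoting-⊲ pQ (f l)
pivoting-⊲ (piv-a a⊲x _) (tf-atom xy) =
  _ , latom , pivoting-atom (≤P-trans (atom-⊲-atom⇒≤P a⊲x) xy)

lemma6p2 : (G H : Fork) → Pivoting G → G ≤G H → Pivoting H
lemma6p2 _ _ = pivoting-≤G
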